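{- Let $n\ge1$ and $0\le m\le n-1$. For every $1\le i\le n$ and every integer $j$ with $\max\{1,\,i-(n-1-m)\}\le j\le\min\{n,\,i+(n-1-m)\}$, there exists a skew-layered permutation $\pi$ of size $n$ with at most $2$ runs such that $T^m(\pi)=b_1\ldots b_n$ satisfies $b_i=j$.
   Context: Runs of a permutation are its maximal increasing strings of consecutive entries; falls are its maximal decreasing strings of consecutive entries. The flip $T$ reverses every fall in place; $T^m$ is its $m$-fold iterate. The skew-layered permutation $\ominus(m_1,\dots,m_s)$ is the skew sum of the identity permutations $\mathrm{id}_{m_1},\dots,\mathrm{id}_{m_s}$ (e.g. $\ominus(2,1,3)=564123$); thus skew-layered permutations of size $n$ with at most two runs are $\mathrm{id}_n$ and $\ominus(n-k,k)=(k+1)(k+2)\cdots n\,1\,2\cdots k$ for $1\le k\le n-1$. -}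

module Defs where

open import Data.Nat using (ℕ; zero; suc; _+_; _<ᵇ_)
open import Data.Bool using (if_then_else_)
open import Data.List using (List; []; _∷_; _++_; map; reverse; concat; length; upTo)
open import Data.Nat.ListAction using (sum)
open import Data.Maybe using (Maybe; just; nothing)

falls : List ℕ → List (List ℕ)
falls [] = []
falls (x ∷ xs) with falls xs
... | [] = (x ∷ []) ∷ []
... | [] ∷ fs = (x ∷ []) ∷ [] ∷ fs
... | (y ∷ ys) ∷ fs = if y <ᵇ x then (x ∷ y ∷ ys) ∷ fs else (x ∷ []) ∷ (y ∷ ys) ∷ fs

runsList : List ℕ → List (List ℕ)
runsList [] = []
runsList (x ∷ xs) with runsList xs
... | [] = (x ∷ []) ∷ []
... | [] ∷ fs = (x ∷ []) ∷ [] ∷ fs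
... | (y ∷ ys) ∷ fs = if x <ᵇ y then (x ∷ y ∷ ys) ∷ fs else (x ∷ []) ∷ (y ∷ ys) ∷ fs

runs : List ℕ → ℕ
runs π = length (runsList π)

flipT : List ℕ → List ℕ
flipT π = concat (map reverse (falls π))

iter : {A : Set} → ℕ → (A → A) → A → A
iter zero f a = a
iter (suc k) f a = f (iter k f a)

idPerm : ℕ → List ℕ
idPerm m = map suc (upTo m)

skewLayered : List ℕ → List ℕ
skewLayered [] = []
skewLayered (m ∷ ms) = map (_+ sum ms) (idPerm m) ++ skewLayered ms

-- 0-indexed entry lookup
nth : List ℕ → ℕ → Maybe ℕ
nth [] _ = nothing
nth (x ∷ xs) zero = just x
nth (x ∷ xs) (suc k) = nth xs k

-- Only the identity (for j = i) and ⊖(A, B) = (B+1 … B+A)(1 … B), A, B ≥ 1,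
-- are used.  Every flip iterate of ⊖(A, B) keeps the small values 1 … B and
-- the large values B+1 … n each in increasing order, so its falls are single
-- entries or "large, small" pairs; hence T acts on the underlying small/large
-- word 1^A 0^B by turning each factor 10 into 01 (iterate-flip).  The t-th
-- iterate of 1^A 0^B is the profile 0^p 1^x (01)^y 0^z 1^q with A = x + y + q,
-- B = p + y + z, t = p + y + q (evolve).  Reading entries off a profile shows
-- that the k-th small entry waits until time k - 1 and then moves left one
-- step per flip until it has moved A steps, and symmetrically for the large
-- entries (restingSmall, movingSmall, restingLarge, movingLarge).  For given
-- i, j, m one chooses A, B putting the right entry at position i at time m
-- (smallEntry for j < i, largeEntry for j > i); the bound |i - j| ≤ n - 1 - m
-- is exactly what makes such A and B exist.
module Submission where

open import Defs
open import Data.Nat using (ℕ; zero; suc; _≤_; _<_; _+_; _∸_; _<ᵇ_; z≤n; s≤s; _<?_; _≤?_)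
open import Data.Nat.Properties
open import Data.Nat.ListAction using (sum)
open import Data.Nat.Tactic.RingSolver
open import Data.Bool using (Bool; true; false; if_then_else_)
open import Data.List using (List; []; _∷_; _++_; map; reverse; concat; replicate; length; upTo; applyUpTo)
open import Data.List.Properties using (++-identityʳ; map-upTo; map-applyUpTo)
open import Data.List.Relation.Unary.All using (All)
import Data.List.Relation.Unary.All as All
open import Data.Maybe using (just)
open import Data.Product using (Σ; _,_; _×_)
open import Data.Sum using (_⊎_; inj₁; inj₂)
open import Data.Empty using (⊥-elim)
open import Relation.Nullary using (yes; no)
open import Relation.Binary using (tri<; tri≈; tri>)
open import Relation.Binary.PropositionalEquality

-- A binary word (true = large, false = small) together with starting
-- labels s and l determines a permutation-like word: the k-th small
-- position gets s + k - 1, the k-th large position gets l + k - 1.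
label : ℕ → ℕ → List Bool → List ℕ
label s l []            = []
label s l (false ∷ w)   = s ∷ label (suc s) l w
label s l (true ∷ w)    = l ∷ label s (suc l) w

smalls : List Bool → ℕ
smalls []          = 0
smalls (false ∷ w) = suc (smalls w)
smalls (true ∷ w)  = smalls w

step : List Bool → List Bool
step []                 = []
step (false ∷ w)        = false ∷ step w
step (true ∷ [])        = true ∷ []
step (true ∷ false ∷ w) = false ∷ true ∷ step w
step (true ∷ true ∷ w)  = true ∷ step (true ∷ w)

-- The falls of label s l w when every small label is below every large
-- one: a large entry directly followed by a small one forms a fall of
-- length two; every other entry is a fall by itself.
labelFalls : ℕ → ℕ → List Bool → List (List ℕ)
labelFalls s l []                 = []
labelFalls s l (false ∷ w)        = (s ∷ []) ∷ labelFalls (suc s) l w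
labelFalls s l (true ∷ [])        = (l ∷ []) ∷ []
labelFalls s l (true ∷ false ∷ w) = (l ∷ s ∷ []) ∷ labelFalls (suc s) (suc l) w
labelFalls s l (true ∷ true ∷ w)  = (l ∷ []) ∷ labelFalls s (suc l) (true ∷ w)

consFall : ℕ → List (List ℕ) → List (List ℕ)
consFall x []              = (x ∷ []) ∷ []
consFall x ([] ∷ fs)       = (x ∷ []) ∷ [] ∷ fs
consFall x ((y ∷ ys) ∷ fs) = if y <ᵇ x then (x ∷ y ∷ ys) ∷ fs else (x ∷ []) ∷ (y ∷ ys) ∷ fs

falls-∷ : ∀ x xs → falls (x ∷ xs) ≡ consFall x (falls xs)
falls-∷ x xs with falls xs
... | []              = refl
... | [] ∷ fs         = refl
... | (y ∷ ys) ∷ fs   = refl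

<ᵇ-false : ∀ {x y} → x ≤ y → (y <ᵇ x) ≡ false
<ᵇ-false {y = zero}  z≤n     = refl
<ᵇ-false {y = suc y} z≤n     = refl
<ᵇ-false             (s≤s p) = <ᵇ-false p

<ᵇ-true : ∀ {x y} → x < y → (x <ᵇ y) ≡ true
<ᵇ-true {zero}  (s≤s p) = refl
<ᵇ-true {suc x} (s≤s p) = <ᵇ-true p

consFall-descent : ∀ x y fs → y < x → consFall x ((y ∷ []) ∷ fs) ≡ (x ∷ y ∷ []) ∷ fs
consFall-descent x y fs y<x rewrite <ᵇ-true y<x = refl

consFall-large : ∀ x s l w → x ≤ l →
                 consFall x (labelFalls s l (true ∷ w)) ≡ (x ∷ []) ∷ labelFalls s l (true ∷ w)
consFall-large x s l []          x≤l rewrite <ᵇ-false x≤l = refl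
consFall-large x s l (false ∷ w) x≤l rewrite <ᵇ-false x≤l = refl
consFall-large x s l (true ∷ w)  x≤l rewrite <ᵇ-false x≤l = refl

consFall-below : ∀ x s l w → x ≤ s → x ≤ l →
                 consFall x (labelFalls s l w) ≡ (x ∷ []) ∷ labelFalls s l w
consFall-below x s l []          x≤s x≤l = refl
consFall-below x s l (false ∷ w) x≤s x≤l rewrite <ᵇ-false x≤s = refl
consFall-below x s l (true ∷ w)  x≤s x≤l = consFall-large x s l w x≤l

falls-label : ∀ s l w → s + smalls w ≤ l → falls (label s l w) ≡ labelFalls s l w
falls-label s l [] _ = refl
falls-label s l (false ∷ w) small<l = begin
  falls (s ∷ label (suc s) l w)             ≡⟨ falls-∷ s (label (suc s) l w) ⟩
  consFall s (falls (label (suc s) l w))    ≡⟨ cong (consFall s) (falls-label (suc s) l w small<l′) ⟩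
  consFall s (labelFalls (suc s) l w)       ≡⟨ consFall-below s (suc s) l w (n≤1+n s) (m+n≤o⇒m≤o s (<⇒≤ small<l′)) ⟩
  (s ∷ []) ∷ labelFalls (suc s) l w         ∎
  where open ≡-Reasoning
        small<l′ : suc s + smalls w ≤ l
        small<l′ = subst (_≤ l) (+-suc s (smalls w)) small<l
falls-label s l (true ∷ []) _ = refl
falls-label s l (true ∷ false ∷ w) small<l = begin
  falls (l ∷ s ∷ label (suc s) (suc l) w)                 ≡⟨ falls-∷ l (s ∷ label (suc s) (suc l) w) ⟩
  consFall l (falls (s ∷ label (suc s) (suc l) w))        ≡⟨ cong (consFall l) (falls-∷ s (label (suc s) (suc l) w)) ⟩
  consFall l (consFall s (falls (label (suc s) (suc l) w))) ≡⟨ cong (λ fs → consFall l (consFall s fs)) (falls-label (suc s) (suc l) w (≤-trans small<l′ (n≤1+n l))) ⟩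
  consFall l (consFall s (labelFalls (suc s) (suc l) w))  ≡⟨ cong (consFall l) (consFall-below s (suc s) (suc l) w (n≤1+n s) (≤-trans (<⇒≤ s<l) (n≤1+n l))) ⟩
  consFall l ((s ∷ []) ∷ labelFalls (suc s) (suc l) w)    ≡⟨ consFall-descent l s _ s<l ⟩
  (l ∷ s ∷ []) ∷ labelFalls (suc s) (suc l) w             ∎
  where open ≡-Reasoning
        small<l′ : suc s + smalls w ≤ l
        small<l′ = subst (_≤ l) (+-suc s (smalls w)) small<l
        s<l : s < l
        s<l = m+n≤o⇒m≤o (suc s) small<l′
falls-label s l (true ∷ true ∷ w) small<l = begin
  falls (l ∷ label s (suc l) (true ∷ w))          ≡⟨ falls-∷ l (label s (suc l) (true ∷ w)) ⟩
  consFall l (falls (label s (suc l) (true ∷ w))) ≡⟨ cong (consFall l) (falls-label s (suc l) (true ∷ w) (≤-trans small<l (n≤1+n l))) ⟩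
  consFall l (labelFalls s (suc l) (true ∷ w))    ≡⟨ consFall-large l s (suc l) w (n≤1+n l) ⟩
  (l ∷ []) ∷ labelFalls s (suc l) (true ∷ w)      ∎
  where open ≡-Reasoning

reverseFalls : ∀ s l w → concat (map reverse (labelFalls s l w)) ≡ label s l (step w)
reverseFalls s l []                 = refl
reverseFalls s l (false ∷ w)        = cong (s ∷_) (reverseFalls (suc s) l w)
reverseFalls s l (true ∷ [])        = refl
reverseFalls s l (true ∷ false ∷ w) = cong (λ t → s ∷ l ∷ t) (reverseFalls (suc s) (suc l) w)
reverseFalls s l (true ∷ true ∷ w)  = cong (l ∷_) (reverseFalls s (suc l) (true ∷ w))

smalls-step : ∀ w → smalls (step w) ≡ smalls w
smalls-step []                 = refl
smalls-step (false ∷ w)        = cong suc (smalls-step w)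
smalls-step (true ∷ [])        = refl
smalls-step (true ∷ false ∷ w) = cong suc (smalls-step w)
smalls-step (true ∷ true ∷ w)  = smalls-step (true ∷ w)

flip-label : ∀ s l w → s + smalls w ≤ l → flipT (label s l w) ≡ label s l (step w)
flip-label s l w small<l =
  trans (cong (λ fs → concat (map reverse fs)) (falls-label s l w small<l)) (reverseFalls s l w)

iterate-flip : ∀ m s l w → s + smalls w ≤ l → iter m flipT (label s l w) ≡ label s l (iter m step w)
iterate-flip zero    s l w small<l = refl
iterate-flip (suc m) s l w small<l = begin
  flipT (iter m flipT (label s l w))  ≡⟨ cong flipT (iterate-flip m s l w small<l) ⟩
  flipT (label s l (iter m step w))   ≡⟨ flip-label s l (iter m step w) (subst (λ k → s + k ≤ l) (sym (smalls-iterate m)) small<l) ⟩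
  label s l (step (iter m step w))    ∎
  where
    open ≡-Reasoning
    smalls-iterate : ∀ k → smalls (iter k step w) ≡ smalls w
    smalls-iterate zero    = refl
    smalls-iterate (suc k) = trans (smalls-step (iter k step w)) (smalls-iterate k)

slPairs : ℕ → List Bool
slPairs zero    = []
slPairs (suc y) = false ∷ true ∷ slPairs y

lsPairs : ℕ → List Bool
lsPairs zero    = []
lsPairs (suc y) = true ∷ false ∷ lsPairs y

-- The profile 0^p 1^x (01)^y 0^z 1^q (0 = small, 1 = large).  Every
-- iterate of the flip on the word 1^A 0^B is a profile.
profile : ℕ → ℕ → ℕ → ℕ → ℕ → List Bool
profile p x y z q =
  replicate p false ++ (replicate x true ++ (slPairs y ++ (replicate z false ++ replicate q true)))

replicate-suc-++ : ∀ {A : Set} x (a : A) v → replicate (suc x) a ++ v ≡ replicate x a ++ (a ∷ v)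
replicate-suc-++ zero    a v = refl
replicate-suc-++ (suc x) a v = cong (a ∷_) (replicate-suc-++ x a v)

replicate-+-++ : ∀ {A : Set} c k (a : A) v → replicate (c + k) a ++ v ≡ replicate c a ++ (replicate k a ++ v)
replicate-+-++ zero    k a v = refl
replicate-+-++ (suc c) k a v = cong (a ∷_) (replicate-+-++ c k a v)

slPairs-+-++ : ∀ c k v → slPairs (c + k) ++ v ≡ slPairs c ++ (slPairs k ++ v)
slPairs-+-++ zero    k v = refl
slPairs-+-++ (suc c) k v = cong (λ u → false ∷ true ∷ u) (slPairs-+-++ c k v)

step-smalls : ∀ p w → step (replicate p false ++ w) ≡ replicate p false ++ step w
step-smalls zero    w = refl
step-smalls (suc p) w = cong (false ∷_) (step-smalls p w)

step-larges : ∀ c w → step (replicate c true ++ (true ∷ w)) ≡ replicate c true ++ step (true ∷ w)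
step-larges zero          w = refl
step-larges (suc zero)    w = refl
step-larges (suc (suc c)) w = cong (true ∷_) (step-larges (suc c) w)

step-lsPairs : ∀ k v → step (lsPairs k ++ v) ≡ slPairs k ++ step v
step-lsPairs zero    v = refl
step-lsPairs (suc k) v = cong (λ u → false ∷ true ∷ u) (step-lsPairs k v)

step-allLarge : ∀ q → step (replicate q true) ≡ replicate q true
step-allLarge zero          = refl
step-allLarge (suc zero)    = refl
step-allLarge (suc (suc q)) = cong (true ∷_) (step-allLarge (suc q))

step-tail : ∀ z q → step (replicate z false ++ replicate q true) ≡ replicate z false ++ replicate q true
step-tail z q = trans (step-smalls z (replicate q true)) (cong (replicate z false ++_) (step-allLarge q))

regroup-small : ∀ y v → true ∷ (slPairs y ++ (false ∷ v)) ≡ lsPairs (suc y) ++ v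
regroup-small zero    v = refl
regroup-small (suc y) v = cong (λ u → true ∷ false ∷ u) (regroup-small y v)

regroup-large : ∀ y v → true ∷ (slPairs y ++ v) ≡ lsPairs y ++ (true ∷ v)
regroup-large zero    v = refl
regroup-large (suc y) v = cong (λ u → true ∷ false ∷ u) (regroup-large y v)

-- The four ways a profile evolves under one flip: the last large entry of
-- 1^x and the first small entry of 0^z both join the alternating middle,
-- or one of the two blocks is already exhausted.
step-interior : ∀ p x y z q → step (profile p (suc x) y (suc z) q) ≡ profile p x (suc y) z q
step-interior p x y z q = begin
  step (replicate p false ++ (replicate (suc x) true ++ (slPairs y ++ (false ∷ R))))
    ≡⟨ step-smalls p _ ⟩
  replicate p false ++ step (replicate (suc x) true ++ (slPairs y ++ (false ∷ R)))
    ≡⟨ cong (λ u → replicate p false ++ step u) (replicate-suc-++ x true _) ⟩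
  replicate p false ++ step (replicate x true ++ (true ∷ (slPairs y ++ (false ∷ R))))
    ≡⟨ cong (λ u → replicate p false ++ step (replicate x true ++ u)) (regroup-small y R) ⟩
  replicate p false ++ step (replicate x true ++ (lsPairs (suc y) ++ R))
    ≡⟨ cong (replicate p false ++_) (step-larges x _) ⟩
  replicate p false ++ (replicate x true ++ step (lsPairs (suc y) ++ R))
    ≡⟨ cong (λ u → replicate p false ++ (replicate x true ++ u)) (step-lsPairs (suc y) R) ⟩
  replicate p false ++ (replicate x true ++ (slPairs (suc y) ++ step R))
    ≡⟨ cong (λ u → replicate p false ++ (replicate x true ++ (slPairs (suc y) ++ u))) (step-tail z q) ⟩
  profile p x (suc y) z q ∎
  where open ≡-Reasoning
        R : List Bool
        R = replicate z false ++ replicate q true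

step-noLarge : ∀ p y z q → step (profile p 0 (suc y) (suc z) q) ≡ profile (suc p) 0 (suc y) z q
step-noLarge p y z q = begin
  step (replicate p false ++ (false ∷ (true ∷ (slPairs y ++ (false ∷ R)))))
    ≡⟨ step-smalls p _ ⟩
  replicate p false ++ (false ∷ step (true ∷ (slPairs y ++ (false ∷ R))))
    ≡⟨ cong (λ u → replicate p false ++ (false ∷ step u)) (regroup-small y R) ⟩
  replicate p false ++ (false ∷ step (lsPairs (suc y) ++ R))
    ≡⟨ cong (λ u → replicate p false ++ (false ∷ u)) (step-lsPairs (suc y) R) ⟩
  replicate p false ++ (false ∷ (slPairs (suc y) ++ step R))
    ≡⟨ cong (λ u → replicate p false ++ (false ∷ (slPairs (suc y) ++ u))) (step-tail z q) ⟩
  replicate p false ++ (false ∷ (slPairs (suc y) ++ R))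
    ≡⟨ sym (replicate-suc-++ p false _) ⟩
  profile (suc p) 0 (suc y) z q ∎
  where open ≡-Reasoning
        R : List Bool
        R = replicate z false ++ replicate q true

step-noSmall : ∀ p x y q → step (profile p (suc x) (suc y) 0 q) ≡ profile p x (suc y) 0 (suc q)
step-noSmall p x y q = begin
  step (replicate p false ++ (replicate (suc x) true ++ (slPairs (suc y) ++ replicate q true)))
    ≡⟨ step-smalls p _ ⟩
  replicate p false ++ step (replicate (suc x) true ++ (slPairs (suc y) ++ replicate q true))
    ≡⟨ cong (λ u → replicate p false ++ step u) (replicate-suc-++ x true _) ⟩
  replicate p false ++ step (replicate x true ++ (true ∷ (slPairs (suc y) ++ replicate q true)))
    ≡⟨ cong (λ u → replicate p false ++ step (replicate x true ++ u)) (regroup-large (suc y) _) ⟩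
  replicate p false ++ step (replicate x true ++ (lsPairs (suc y) ++ replicate (suc q) true))
    ≡⟨ cong (replicate p false ++_) (step-larges x _) ⟩
  replicate p false ++ (replicate x true ++ step (lsPairs (suc y) ++ replicate (suc q) true))
    ≡⟨ cong (λ u → replicate p false ++ (replicate x true ++ u)) (step-lsPairs (suc y) _) ⟩
  replicate p false ++ (replicate x true ++ (slPairs (suc y) ++ step (replicate (suc q) true)))
    ≡⟨ cong (λ u → replicate p false ++ (replicate x true ++ (slPairs (suc y) ++ u))) (step-allLarge (suc q)) ⟩
  profile p x (suc y) 0 (suc q) ∎
  where open ≡-Reasoning

step-neither : ∀ p y q → step (profile p 0 (suc y) 0 q) ≡ profile (suc p) 0 y 0 (suc q)
step-neither p y q = begin
  step (replicate p false ++ (false ∷ (true ∷ (slPairs y ++ replicate q true))))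
    ≡⟨ step-smalls p _ ⟩
  replicate p false ++ (false ∷ step (true ∷ (slPairs y ++ replicate q true)))
    ≡⟨ cong (λ u → replicate p false ++ (false ∷ step u)) (regroup-large y _) ⟩
  replicate p false ++ (false ∷ step (lsPairs y ++ replicate (suc q) true))
    ≡⟨ cong (λ u → replicate p false ++ (false ∷ u)) (step-lsPairs y _) ⟩
  replicate p false ++ (false ∷ (slPairs y ++ step (replicate (suc q) true)))
    ≡⟨ cong (λ u → replicate p false ++ (false ∷ (slPairs y ++ u))) (step-allLarge (suc q)) ⟩
  replicate p false ++ (false ∷ (slPairs y ++ replicate (suc q) true))
    ≡⟨ sym (replicate-suc-++ p false _) ⟩
  profile (suc p) 0 y 0 (suc q) ∎
  where open ≡-Reasoning

-- A word w is the t-th flip iterate of 1^A 0^B in profile form: it is a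
-- profile 0^p 1^x (01)^y 0^z 1^q with A larges, B smalls, t = p + y + q,
-- and at most one of the blocks 0^p, 1^x and at most one of 0^z, 1^q
-- nonempty.
record Profiled (A B t : ℕ) (w : List Bool) : Set where
  constructor profiled
  field
    p x y z q    : ℕ
    word         : w ≡ profile p x y z q
    larges       : A ≡ x + y + q
    smallCount   : B ≡ p + y + z
    time         : t ≡ p + y + q
    leftSettled  : p ≡ 0 ⊎ x ≡ 0
    rightSettled : q ≡ 0 ⊎ z ≡ 0

-- The case split is on
-- which of 1^x and 0^z are exhausted; when one is, the middle (01)^y is
-- nonempty because A, B ≥ 1, and when both are, because t < A + B.
step-profiled : ∀ {A B t w} → 1 ≤ A → 1 ≤ B → t < A + B → Profiled A B t w → Profiled A B (suc t) (step w)
step-profiled _ _ _ (profiled p (suc x) y (suc z) q refl refl refl refl (inj₁ refl) (inj₁ refl)) =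
  profiled 0 x (suc y) z 0 (step-interior 0 x y z 0) (solve (x ∷ y ∷ [])) (solve (y ∷ z ∷ [])) refl (inj₁ refl) (inj₁ refl)
step-profiled _ () _ (profiled p (suc x) zero zero q refl refl refl refl (inj₁ refl) _)
step-profiled _ _ _ (profiled p (suc x) (suc y) zero q refl refl refl refl (inj₁ refl) _) =
  profiled 0 x (suc y) 0 (suc q) (step-noSmall 0 x y q) (solve (x ∷ y ∷ q ∷ [])) refl (solve (y ∷ q ∷ [])) (inj₁ refl) (inj₂ refl)
step-profiled () _ _ (profiled p zero zero (suc z) q refl refl refl refl _ (inj₁ refl))
step-profiled _ _ _ (profiled p zero (suc y) (suc z) q refl refl refl refl _ (inj₁ refl)) =
  profiled (suc p) 0 (suc y) z 0 (step-noLarge p y z 0) refl (solve (p ∷ y ∷ z ∷ [])) refl (inj₂ refl) (inj₁ refl)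
step-profiled _ _ t<A+B (profiled p zero zero zero q refl refl refl refl _ _) =
  ⊥-elim (<-irrefl {p + 0 + q} {q + (p + 0 + 0)} (solve (p ∷ q ∷ [])) t<A+B)
step-profiled _ _ _ (profiled p zero (suc y) zero q refl refl refl refl _ _) =
  profiled (suc p) 0 y 0 (suc q) (step-neither p y q) (solve (y ∷ q ∷ [])) (solve (p ∷ y ∷ [])) (solve (p ∷ y ∷ q ∷ [])) (inj₂ refl) (inj₂ refl)
step-profiled _ _ _ (profiled p (suc x) _ _ q _ _ _ _ (inj₂ ()) _)
step-profiled _ _ _ (profiled p _ _ (suc z) q _ _ _ _ _ (inj₂ ()))

twoBlocks : ℕ → ℕ → List Bool
twoBlocks A B = profile 0 A 0 B 0

evolve : ∀ {A B} t → 1 ≤ A → 1 ≤ B → t ≤ A + B → Profiled A B t (iter t step (twoBlocks A B))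
evolve {A} {B} zero _ _ _ = profiled 0 A 0 B 0 refl (solve (A ∷ [])) refl refl (inj₁ refl) (inj₁ refl)
evolve (suc t) 1≤A 1≤B t<A+B = step-profiled 1≤A 1≤B t<A+B (evolve t 1≤A 1≤B (<⇒≤ t<A+B))

nth-smalls : ∀ p s l v d → nth (label s l (replicate p false ++ v)) (p + d) ≡ nth (label (p + s) l v) d
nth-smalls zero    s l v d = refl
nth-smalls (suc p) s l v d = trans (nth-smalls p (suc s) l v d) (cong (λ s′ → nth (label s′ l v) d) (+-suc p s))

nth-larges : ∀ x s l v d → nth (label s l (replicate x true ++ v)) (x + d) ≡ nth (label s (x + l) v) d
nth-larges zero    s l v d = refl
nth-larges (suc x) s l v d = trans (nth-larges x s (suc l) v d) (cong (λ l′ → nth (label s l′ v) d) (+-suc x l))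

nth-slPairs : ∀ c s l v d → nth (label s l (slPairs c ++ v)) (c + c + d) ≡ nth (label (c + s) (c + l) v) d
nth-slPairs zero    s l v d = refl
nth-slPairs (suc c) s l v d = begin
  nth (label s l (slPairs (suc c) ++ v)) (suc c + suc c + d)
    ≡⟨ cong (nth (label s l (slPairs (suc c) ++ v))) twoMore ⟩
  nth (label (suc s) (suc l) (slPairs c ++ v)) (c + c + d)
    ≡⟨ nth-slPairs c (suc s) (suc l) v d ⟩
  nth (label (c + suc s) (c + suc l) v) d
    ≡⟨ cong₂ (λ s′ l′ → nth (label s′ l′ v) d) (+-suc c s) (+-suc c l) ⟩
  nth (label (suc c + s) (suc c + l) v) d ∎
  where open ≡-Reasoning
        twoMore : suc c + suc c + d ≡ suc (suc (c + c + d))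
        twoMore = solve (c ∷ d ∷ [])

-- Block
-- size, position and value are passed as equations, to be discharged by
-- the ring solver at the call sites.
lookup-left-large : ∀ s l p x y z q c r pos v → x ≡ c + suc r → pos ≡ p + (c + 0) → v ≡ c + l →
                nth (label s l (profile p x y z q)) pos ≡ just v
lookup-left-large s l p _ y z q c r _ _ refl refl refl = begin
  nth (label s l (replicate p false ++ (replicate (c + suc r) true ++ R))) (p + (c + 0))
    ≡⟨ nth-smalls p s l _ (c + 0) ⟩
  nth (label (p + s) l (replicate (c + suc r) true ++ R)) (c + 0)
    ≡⟨ cong (λ u → nth (label (p + s) l u) (c + 0)) (replicate-+-++ c (suc r) true R) ⟩
  nth (label (p + s) l (replicate c true ++ (replicate (suc r) true ++ R))) (c + 0)
    ≡⟨ nth-larges c (p + s) l _ 0 ⟩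
  just (c + l) ∎
  where open ≡-Reasoning
        R : List Bool
        R = slPairs y ++ (replicate z false ++ replicate q true)

lookup-middle-small : ∀ s l p x y z q c r pos v → y ≡ c + suc r → pos ≡ p + (x + (c + c + 0)) → v ≡ c + (p + s) →
                  nth (label s l (profile p x y z q)) pos ≡ just v
lookup-middle-small s l p x _ z q c r _ _ refl refl refl = begin
  nth (label s l (profile p x (c + suc r) z q)) (p + (x + (c + c + 0)))
    ≡⟨ trans (nth-smalls p s l _ _) (nth-larges x (p + s) l _ _) ⟩
  nth (label (p + s) (x + l) (slPairs (c + suc r) ++ R)) (c + c + 0)
    ≡⟨ cong (λ u → nth (label (p + s) (x + l) u) (c + c + 0)) (slPairs-+-++ c (suc r) R) ⟩
  nth (label (p + s) (x + l) (slPairs c ++ (slPairs (suc r) ++ R))) (c + c + 0)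
    ≡⟨ nth-slPairs c (p + s) (x + l) _ 0 ⟩
  just (c + (p + s)) ∎
  where open ≡-Reasoning
        R : List Bool
        R = replicate z false ++ replicate q true

lookup-middle-large : ∀ s l p x y z q c r pos v → y ≡ c + suc r → pos ≡ p + (x + (c + c + 1)) → v ≡ c + (x + l) →
                  nth (label s l (profile p x y z q)) pos ≡ just v
lookup-middle-large s l p x _ z q c r _ _ refl refl refl = begin
  nth (label s l (profile p x (c + suc r) z q)) (p + (x + (c + c + 1)))
    ≡⟨ trans (nth-smalls p s l _ _) (nth-larges x (p + s) l _ _) ⟩
  nth (label (p + s) (x + l) (slPairs (c + suc r) ++ R)) (c + c + 1)
    ≡⟨ cong (λ u → nth (label (p + s) (x + l) u) (c + c + 1)) (slPairs-+-++ c (suc r) R) ⟩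
  nth (label (p + s) (x + l) (slPairs c ++ (slPairs (suc r) ++ R))) (c + c + 1)
    ≡⟨ nth-slPairs c (p + s) (x + l) _ 1 ⟩
  just (c + (x + l)) ∎
  where open ≡-Reasoning
        R : List Bool
        R = replicate z false ++ replicate q true

lookup-right-small : ∀ s l p x y z q c r pos v → z ≡ c + suc r → pos ≡ p + (x + (y + y + (c + 0))) → v ≡ c + (y + (p + s)) →
                 nth (label s l (profile p x y z q)) pos ≡ just v
lookup-right-small s l p x y _ q c r _ _ refl refl refl = begin
  nth (label s l (profile p x y (c + suc r) q)) (p + (x + (y + y + (c + 0))))
    ≡⟨ trans (nth-smalls p s l _ _) (trans (nth-larges x (p + s) l _ _) (nth-slPairs y (p + s) (x + l) _ _)) ⟩
  nth (label (y + (p + s)) (y + (x + l)) (replicate (c + suc r) false ++ replicate q true)) (c + 0)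
    ≡⟨ cong (λ u → nth (label (y + (p + s)) (y + (x + l)) u) (c + 0)) (replicate-+-++ c (suc r) false _) ⟩
  nth (label (y + (p + s)) (y + (x + l)) (replicate c false ++ (replicate (suc r) false ++ replicate q true))) (c + 0)
    ≡⟨ nth-smalls c (y + (p + s)) (y + (x + l)) _ 0 ⟩
  just (c + (y + (p + s))) ∎
  where open ≡-Reasoning

-- In word form the
-- k-th small entry (value k) and the k-th large entry (value B + k) move
-- like particles: a small one waits until time k - 1, then moves one step
-- left per flip until it has moved A steps; symmetrically for large ones.
-- Positions are 0-based; all statements are about a profiled word.

small-in-right : ∀ p x y z k pos → p + y < k → k ≤ p + y + z → pos + 1 ≡ x + y + 0 + k →
                  nth (label 1 (suc (p + y + z)) (profile p x y z 0)) pos ≡ just k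
small-in-right p x y z k pos p+y<k k≤B pos+1 with m≤n⇒∃[o]m+o≡n p+y<k
... | c , refl with m≤n⇒∃[o]m+o≡n (+-cancelˡ-≤ (p + y) (suc c) z (≤-trans (≤-reflexive (+-suc (p + y) c)) k≤B))
... | r , refl = lookup-right-small 1 _ p x y (suc c + r) 0 c r pos _ block position value
  where
    block : suc c + r ≡ c + suc r
    block = sym (+-suc c r)
    position : pos ≡ p + (x + (y + y + (c + 0)))
    position = +-cancelʳ-≡ 1 pos _ (trans pos+1 (solve (p ∷ x ∷ y ∷ c ∷ [])))
    value : suc (p + y) + c ≡ c + (y + (p + 1))
    value = solve (p ∷ y ∷ c ∷ [])

restingSmall : ∀ {A B t w k pos} → Profiled A B t w → t < k → k ≤ B → pos + 1 ≡ A + k →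
               nth (label 1 (suc B) w) pos ≡ just k
-- (0^z cannot be empty: then B = p + y ≤ t < k.)
restingSmall (profiled p x y z q refl refl refl refl _ (inj₂ refl)) t<k k≤B _ =
  ⊥-elim (≤⇒≯ (+-monoʳ-≤ (p + y) z≤n) (<-≤-trans t<k k≤B))
restingSmall {k = k} {pos} (profiled p x y z q refl refl refl refl _ (inj₁ refl)) t<k k≤B pos+1 =
  small-in-right p x y z k pos (≤-trans (≤-reflexive (cong suc (sym (+-identityʳ _)))) t<k) k≤B pos+1

small-in-middle : ∀ p x y z q k pos → p < k → k ≤ p + y → pos + (p + y + q) + 2 ≡ x + y + q + (k + k) →
                   nth (label 1 (suc (p + y + z)) (profile p x y z q)) pos ≡ just k
small-in-middle p x y z q k pos p<k k≤p+y pos+t with m≤n⇒∃[o]m+o≡n p<k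
... | c , refl with m≤n⇒∃[o]m+o≡n (+-cancelˡ-≤ p (suc c) y (≤-trans (≤-reflexive (+-suc p c)) k≤p+y))
... | r , refl = lookup-middle-small 1 _ p x (suc c + r) z q c r pos _ block position value
  where
    block : suc c + r ≡ c + suc r
    block = sym (+-suc c r)
    position : pos ≡ p + (x + (c + c + 0))
    position = +-cancelʳ-≡ (p + (suc c + r) + q + 2) pos _
                 (trans (sym (+-assoc pos _ 2)) (trans pos+t (solve (p ∷ x ∷ q ∷ c ∷ r ∷ []))))
    value : suc p + c ≡ c + (p + 1)
    value = solve (p ∷ c ∷ [])

movingSmall : ∀ {A B t w k pos} → Profiled A B t w → 1 ≤ k → k ≤ t → k ≤ B → t + 2 ≤ A + k →
              pos + t + 2 ≡ A + (k + k) → nth (label 1 (suc B) w) pos ≡ just k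
movingSmall {k = k} {pos} (profiled p x y z q refl refl refl refl left right) 1≤k k≤t k≤B unarrived pos+t =
  small-in-middle p x y z q k pos (p<k left) (k≤p+y right) pos+t
  where
    -- If 0^p is nonempty then 1^x is empty, t = A + p, and p < k since the
    -- entry has not arrived.
    p<k : p ≡ 0 ⊎ x ≡ 0 → p < k
    p<k (inj₁ p≡0) = subst (_< k) (sym p≡0) 1≤k
    p<k (inj₂ x≡0) = +-cancelʳ-≤ (y + q) (suc p) k (begin
      suc p + (y + q)    ≤⟨ n≤1+n _ ⟩
      suc (suc p + (y + q)) ≡⟨ solve (p ∷ y ∷ q ∷ []) ⟩
      p + y + q + 2      ≤⟨ unarrived ⟩
      x + y + q + k      ≡⟨ cong (λ x′ → x′ + y + q + k) x≡0 ⟩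
      y + q + k          ≡⟨ +-comm (y + q) k ⟩
      k + (y + q)        ∎)
      where open ≤-Reasoning
    -- If 1^q is empty then p + y = t ≥ k, otherwise 0^z is empty and p + y = B ≥ k.
    k≤p+y : q ≡ 0 ⊎ z ≡ 0 → k ≤ p + y
    k≤p+y (inj₁ q≡0) = ≤-trans k≤t (≤-reflexive (trans (cong (p + y +_) q≡0) (+-identityʳ _)))
    k≤p+y (inj₂ z≡0) = ≤-trans k≤B (≤-reflexive (trans (cong (p + y +_) z≡0) (+-identityʳ _)))

large-in-left : ∀ x y z q k pos → 1 ≤ k → k ≤ x → pos + 1 ≡ k →
                 nth (label 1 (suc (y + z)) (profile 0 x y z q)) pos ≡ just (y + z + k)
large-in-left x y z q (suc c) pos _ k≤x pos+1 with m≤n⇒∃[o]m+o≡n k≤x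
... | r , refl = lookup-left-large 1 _ 0 (suc c + r) y z q c r pos _ block position value
  where
    block : suc c + r ≡ c + suc r
    block = sym (+-suc c r)
    position : pos ≡ c + 0
    position = +-cancelʳ-≡ 1 pos _ (trans pos+1 (solve (c ∷ [])))
    value : y + z + suc c ≡ c + suc (y + z)
    value = solve (y ∷ z ∷ c ∷ [])

restingLarge : ∀ {A B t w k pos} → Profiled A B t w → 1 ≤ k → k + t ≤ A → pos + 1 ≡ k →
               nth (label 1 (suc B) w) pos ≡ just (B + k)
-- (1^x cannot be empty: then A = y + q ≤ t < k + t.)
restingLarge {k = k} (profiled p zero y z q refl refl refl refl (inj₂ refl) _) 1≤k k+t≤A _ =
  ⊥-elim (<-irrefl refl (begin-strict
    y + q          ≤⟨ m≤n+m (y + q) p ⟩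
    p + (y + q)    ≡⟨ sym (+-assoc p y q) ⟩
    p + y + q      <⟨ m<n+m (p + y + q) 1≤k ⟩
    k + (p + y + q) ≤⟨ k+t≤A ⟩
    y + q          ∎))
  where open ≤-Reasoning
restingLarge {k = k} {pos} (profiled zero x y z q refl refl refl refl (inj₁ refl) _) 1≤k k+t≤A pos+1 =
  large-in-left x y z q k pos 1≤k (+-cancelʳ-≤ (y + q) k x (≤-trans k+t≤A (≤-reflexive (+-assoc x y q)))) pos+1

large-in-middle : ∀ p x y z q k pos → x < k → k ≤ x + y → pos + (x + y + q) + 1 ≡ k + k + (p + y + q) →
                   nth (label 1 (suc (p + y + z)) (profile p x y z q)) pos ≡ just (p + y + z + k)
large-in-middle p x y z q k pos x<k k≤x+y pos+A with m≤n⇒∃[o]m+o≡n x<k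
... | c , refl with m≤n⇒∃[o]m+o≡n (+-cancelˡ-≤ x (suc c) y (≤-trans (≤-reflexive (+-suc x c)) k≤x+y))
... | r , refl = lookup-middle-large 1 _ p x (suc c + r) z q c r pos _ block position value
  where
    block : suc c + r ≡ c + suc r
    block = sym (+-suc c r)
    position : pos ≡ p + (x + (c + c + 1))
    position = +-cancelʳ-≡ (x + (suc c + r) + q + 1) pos _
                 (trans (sym (+-assoc pos _ 1)) (trans pos+A (solve (p ∷ x ∷ q ∷ c ∷ r ∷ []))))
    value : p + (suc c + r) + z + suc (x + c) ≡ c + (x + suc (p + (suc c + r) + z))
    value = solve (p ∷ x ∷ z ∷ c ∷ r ∷ [])

movingLarge : ∀ {A B t w k pos} → Profiled A B t w → 1 ≤ k → k ≤ A → A < t + k → t + k < A + B →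
              pos + A + 1 ≡ k + k + t → nth (label 1 (suc B) w) pos ≡ just (B + k)
movingLarge {k = k} {pos} (profiled p x y z q refl refl refl refl left right) 1≤k k≤A started unarrived pos+A =
  large-in-middle p x y z q k pos (x<k left) (k≤x+y right) pos+A
  where
    open ≤-Reasoning
    -- If 1^x is nonempty then 0^p is empty, x = A - t, and x < k since the
    -- entry has started.
    x<k : p ≡ 0 ⊎ x ≡ 0 → x < k
    x<k (inj₁ p≡0) = +-cancelʳ-< (y + q) x k (begin-strict
      x + (y + q)        ≡⟨ sym (+-assoc x y q) ⟩
      x + y + q          <⟨ started ⟩
      p + y + q + k      ≡⟨ cong (λ p′ → p′ + y + q + k) p≡0 ⟩
      y + q + k          ≡⟨ +-comm (y + q) k ⟩
      k + (y + q)        ∎)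
    x<k (inj₂ x≡0) = subst (_< k) (sym x≡0) 1≤k
    -- If 1^q is empty then k ≤ A = x + y; otherwise 0^z is empty, t = B + q,
    -- and k ≤ x + y since the entry has not arrived.
    k≤x+y : q ≡ 0 ⊎ z ≡ 0 → k ≤ x + y
    k≤x+y (inj₁ q≡0) = ≤-trans k≤A (≤-reflexive (trans (cong (x + y +_) q≡0) (+-identityʳ _)))
    k≤x+y (inj₂ z≡0) = <⇒≤ (+-cancelʳ-< (p + y + q) k (x + y) (begin-strict
      k + (p + y + q)          ≡⟨ +-comm k _ ⟩
      p + y + q + k            <⟨ unarrived ⟩
      x + y + q + (p + y + z)  ≡⟨ cong (λ z′ → x + y + q + (p + y + z′)) z≡0 ⟩
      x + y + q + (p + y + 0)  ≡⟨ solve (p ∷ x ∷ y ∷ q ∷ []) ⟩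
      x + y + (p + y + q)      ∎))

run : ℕ → ℕ → List ℕ
run c zero    = []
run c (suc a) = c ∷ run (suc c) a

applyUpTo-run : ∀ (f : ℕ → ℕ) c a → (∀ x → f x ≡ c + x) → applyUpTo f a ≡ run c a
applyUpTo-run f c zero    f≗ = refl
applyUpTo-run f c (suc a) f≗ =
  cong₂ _∷_ (trans (f≗ 0) (+-identityʳ c)) (applyUpTo-run (λ x → f (suc x)) (suc c) a (λ x → trans (f≗ (suc x)) (+-suc c x)))

shiftedIdentity : ∀ c a → map (_+ c) (idPerm a) ≡ run (suc c) a
shiftedIdentity c a = begin
  map (_+ c) (map suc (upTo a))    ≡⟨ cong (map (_+ c)) (map-upTo suc a) ⟩
  map (_+ c) (applyUpTo suc a)     ≡⟨ map-applyUpTo suc (_+ c) a ⟩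
  applyUpTo (λ x → suc x + c) a    ≡⟨ applyUpTo-run (λ x → suc x + c) (suc c) a (λ x → cong suc (+-comm x c)) ⟩
  run (suc c) a                    ∎
  where open ≡-Reasoning

skewLayered-two : ∀ a b → skewLayered (a ∷ b ∷ []) ≡ run (suc b) a ++ run 1 b
skewLayered-two a b = begin
  map (_+ (b + 0)) (idPerm a) ++ (map (_+ 0) (idPerm b) ++ [])
    ≡⟨ cong₂ (λ c u → map (_+ c) (idPerm a) ++ u) (+-identityʳ b) (++-identityʳ _) ⟩
  map (_+ b) (idPerm a) ++ map (_+ 0) (idPerm b)
    ≡⟨ cong₂ _++_ (shiftedIdentity b a) (shiftedIdentity 0 b) ⟩
  run (suc b) a ++ run 1 b ∎
  where open ≡-Reasoning

skewLayered-one : ∀ n → skewLayered (n ∷ []) ≡ run 1 n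
skewLayered-one n = trans (++-identityʳ _) (shiftedIdentity 0 n)

label-twoBlocks : ∀ s l a b → label s l (twoBlocks a b) ≡ run l a ++ run s b
label-twoBlocks s l (suc a) b       = cong (l ∷_) (label-twoBlocks s (suc l) a b)
label-twoBlocks s l zero    (suc b) = cong (s ∷_) (label-twoBlocks (suc s) l zero b)
label-twoBlocks s l zero    zero    = refl

label-larges : ∀ s l a → label s l (replicate a true) ≡ run l a
label-larges s l zero    = refl
label-larges s l (suc a) = cong (l ∷_) (label-larges s (suc l) a)

smalls-twoBlocks : ∀ a b → smalls (twoBlocks a b) ≡ b
smalls-twoBlocks (suc a) b       = smalls-twoBlocks a b
smalls-twoBlocks zero    (suc b) = cong suc (smalls-twoBlocks zero b)
smalls-twoBlocks zero    zero    = refl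

smalls-larges : ∀ a → smalls (replicate a true) ≡ 0
smalls-larges zero    = refl
smalls-larges (suc a) = smalls-larges a

nth-run : ∀ c a pos → pos < a → nth (run c a) pos ≡ just (pos + c)
nth-run c (suc a) zero      _             = refl
nth-run c (suc a) (suc pos) (s≤s pos<a) = trans (nth-run (suc c) a pos pos<a) (cong just (+-suc pos c))

consRun : ℕ → List (List ℕ) → List (List ℕ)
consRun x []              = (x ∷ []) ∷ []
consRun x ([] ∷ rs)       = (x ∷ []) ∷ [] ∷ rs
consRun x ((y ∷ ys) ∷ rs) = if x <ᵇ y then (x ∷ y ∷ ys) ∷ rs else (x ∷ []) ∷ (y ∷ ys) ∷ rs

runsList-∷ : ∀ x xs → runsList (x ∷ xs) ≡ consRun x (runsList xs)
runsList-∷ x xs with runsList xs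
... | []            = refl
... | [] ∷ rs       = refl
... | (y ∷ ys) ∷ rs = refl

consRun-descent : ∀ x y rs → y ≤ x → consRun x (consRun y rs) ≡ (x ∷ []) ∷ consRun y rs
consRun-descent x y []              y≤x rewrite <ᵇ-false y≤x = refl
consRun-descent x y ([] ∷ rs)       y≤x rewrite <ᵇ-false y≤x = refl
consRun-descent x y ((z ∷ zs) ∷ rs) y≤x with y <ᵇ z
... | true  rewrite <ᵇ-false y≤x = refl
... | false rewrite <ᵇ-false y≤x = refl

consRun-run : ∀ c a rs → consRun c ((suc c ∷ run (suc (suc c)) a) ∷ rs) ≡ (c ∷ suc c ∷ run (suc (suc c)) a) ∷ rs
consRun-run c a rs rewrite <ᵇ-true (n<1+n c) = refl

runsList-run : ∀ c a → runsList (run c (suc a)) ≡ run c (suc a) ∷ []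
runsList-run c zero    = refl
runsList-run c (suc a) =
  trans (runsList-∷ c (run (suc c) (suc a))) (trans (cong (consRun c) (runsList-run (suc c) a)) (consRun-run c a []))

runsList-run-++ : ∀ c a y ys → y ≤ c → runsList (run c (suc a) ++ (y ∷ ys)) ≡ run c (suc a) ∷ runsList (y ∷ ys)
runsList-run-++ c zero y ys y≤c =
  trans (runsList-∷ c (y ∷ ys)) (trans (cong (consRun c) (runsList-∷ y ys))
    (trans (consRun-descent c y (runsList ys) y≤c) (cong ((c ∷ []) ∷_) (sym (runsList-∷ y ys)))))
runsList-run-++ c (suc a) y ys y≤c =
  trans (runsList-∷ c (run (suc c) (suc a) ++ (y ∷ ys)))
  (trans (cong (consRun c) (runsList-run-++ (suc c) a y ys (≤-trans y≤c (n≤1+n c)))) (consRun-run c a _))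

-- The conclusion of the theorem: some skew-layered permutation of size n
-- with at most two runs has value v at (0-based) position pos of T^m.
Realisable : ℕ → ℕ → ℕ → ℕ → Set
Realisable n m pos v = Σ (List ℕ) λ parts → Σ (List ℕ) λ π →
  All (1 ≤_) parts × sum parts ≡ n × π ≡ skewLayered parts × runs π ≤ 2
  × nth (iter m flipT π) pos ≡ just v

identityRealises : ∀ {n} m pos → pos < n → Realisable n m pos (suc pos)
identityRealises {suc n′} m pos pos<n =
  (n ∷ []) , skewLayered (n ∷ []) , s≤s z≤n All.∷ All.[] , +-identityʳ n , refl , oneRun , entry
  where
    n : ℕ
    n = suc n′
    identity≡ : skewLayered (n ∷ []) ≡ label 1 1 (replicate n true)
    identity≡ = trans (skewLayered-one n) (sym (label-larges 1 1 n))
    oneRun : runs (skewLayered (n ∷ [])) ≤ 2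
    oneRun = ≤-trans (≤-reflexive (cong length (trans (cong runsList (skewLayered-one n)) (runsList-run 1 n′)))) (n≤1+n 1)
    fixed : ∀ k → iter k step (replicate n true) ≡ replicate n true
    fixed zero    = refl
    fixed (suc k) = trans (cong step (fixed k)) (step-allLarge n)
    open ≡-Reasoning
    entry : nth (iter m flipT (skewLayered (n ∷ []))) pos ≡ just (suc pos)
    entry = begin
      nth (iter m flipT (skewLayered (n ∷ []))) pos          ≡⟨ cong (λ π → nth (iter m flipT π) pos) identity≡ ⟩
      nth (iter m flipT (label 1 1 (replicate n true))) pos  ≡⟨ cong (λ π → nth π pos) (iterate-flip m 1 1 _ (≤-reflexive (cong suc (smalls-larges n)))) ⟩
      nth (label 1 1 (iter m step (replicate n true))) pos   ≡⟨ cong (λ w → nth (label 1 1 w) pos) (fixed m) ⟩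
      nth (label 1 1 (replicate n true)) pos                 ≡⟨ cong (λ π → nth π pos) (label-larges 1 1 n) ⟩
      nth (run 1 n) pos                                      ≡⟨ nth-run 1 n pos pos<n ⟩
      just (pos + 1)                                         ≡⟨ cong just (+-comm pos 1) ⟩
      just (suc pos)                                         ∎

twoLayersRealise : ∀ A B m pos {v} → 1 ≤ A → 1 ≤ B →
                   nth (label 1 (suc B) (iter m step (twoBlocks A B))) pos ≡ just v → Realisable (A + B) m pos v
twoLayersRealise (suc a) (suc b) m pos {v} _ _ evolved =
  (A ∷ B ∷ []) , skewLayered (A ∷ B ∷ []) , s≤s z≤n All.∷ s≤s z≤n All.∷ All.[] , cong (A +_) (+-identityʳ B) , refl ,
  ≤-reflexive twoRuns , entry
  where
    A B : ℕ
    A = suc a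
    B = suc b
    open ≡-Reasoning
    twoRuns : runs (skewLayered (A ∷ B ∷ [])) ≡ 2
    twoRuns = cong length (begin
      runsList (skewLayered (A ∷ B ∷ []))                ≡⟨ cong runsList (skewLayered-two A B) ⟩
      runsList (run (suc B) A ++ (1 ∷ run 2 b))           ≡⟨ runsList-run-++ (suc B) a 1 (run 2 b) (s≤s z≤n) ⟩
      run (suc B) A ∷ runsList (run 1 B)                  ≡⟨ cong (run (suc B) A ∷_) (runsList-run 1 b) ⟩
      run (suc B) A ∷ run 1 B ∷ []                        ∎)
    skew≡ : skewLayered (A ∷ B ∷ []) ≡ label 1 (suc B) (twoBlocks A B)
    skew≡ = trans (skewLayered-two A B) (sym (label-twoBlocks 1 (suc B) A B))
    entry : nth (iter m flipT (skewLayered (A ∷ B ∷ []))) pos ≡ just v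
    entry = begin
      nth (iter m flipT (skewLayered (A ∷ B ∷ []))) pos            ≡⟨ cong (λ π → nth (iter m flipT π) pos) skew≡ ⟩
      nth (iter m flipT (label 1 (suc B) (twoBlocks A B))) pos     ≡⟨ cong (λ π → nth π pos) (iterate-flip m 1 (suc B) _ (≤-reflexive (cong suc (smalls-twoBlocks A B)))) ⟩
      nth (label 1 (suc B) (iter m step (twoBlocks A B))) pos      ≡⟨ evolved ⟩
      just v                                                        ∎

realisable-cong : ∀ {n n′} m pos {v v′} → n ≡ n′ → v ≡ v′ → Realisable n m pos v → Realisable n′ m pos v′
realisable-cong m pos refl refl r = r

≤-by : ∀ {a b} e → a + e ≡ b → a ≤ b
≤-by e refl = m≤m+n _ e

-- For a small entry v at pos = v + g at time m = v + u, with n = pos + 1 + e,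
-- the bound pos + m + 1 < v + n says u < e.
movedBound : ∀ v g u e → v + g + (v + u) + 1 < v + (suc (v + g) + e) → u < e
movedBound v g u e close = +-cancelˡ-≤ (suc (v + (v + g))) (suc u) e (begin
  suc (v + (v + g)) + suc u        ≡⟨ solve (v ∷ g ∷ u ∷ []) ⟩
  suc (v + g + (v + u) + 1)        ≤⟨ close ⟩
  v + (suc (v + g) + e)            ≡⟨ solve (v ∷ g ∷ e ∷ []) ⟩
  suc (v + (v + g)) + e            ∎)
  where open ≤-Reasoning

-- The value v is smaller than the position pos + 1, at distance G = pos + 1 - v
-- ≤ n - 1 - m.  The v-th small entry of ⊖(A, n - A) is used: it is still
-- resting when m < v and A = G, and it has moved exactly G steps when
-- v ≤ m and A = G + m + 1 - v.
smallEntry : ∀ {n m pos v} → 1 ≤ v → v ≤ pos → pos < n → pos + m + 1 < v + n → Realisable n m pos v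
smallEntry {m = m} {v = v} 1≤v v≤pos pos<n close with m≤n⇒∃[o]m+o≡n v≤pos
... | g , refl with m≤n⇒∃[o]m+o≡n pos<n
... | e , refl with m <? v
... | yes m<v = realisable-cong m (v + g) size refl (twoLayersRealise (suc g) (v + e) m (v + g) (s≤s z≤n) 1≤B entry)
  where
    1≤B : 1 ≤ v + e
    1≤B = ≤-trans 1≤v (m≤m+n v e)
    size : suc g + (v + e) ≡ suc (v + g) + e
    size = solve (g ∷ v ∷ e ∷ [])
    m≤A+B : m ≤ suc g + (v + e)
    m≤A+B = ≤-trans (<⇒≤ m<v) (≤-by (suc (g + e)) (solve (v ∷ g ∷ e ∷ [])))
    position : v + g + 1 ≡ suc g + v
    position = solve (v ∷ g ∷ [])
    entry : nth (label 1 (suc (v + e)) (iter m step (twoBlocks (suc g) (v + e)))) (v + g) ≡ just v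
    entry = restingSmall (evolve m (s≤s z≤n) 1≤B m≤A+B) m<v (m≤m+n v e) position
... | no m≮v with m≤n⇒∃[o]m+o≡n (≮⇒≥ m≮v)
... | u , refl with m≤n⇒∃[o]m+o≡n (movedBound v g u e close)
... | e′ , refl = realisable-cong (v + u) (v + g) size refl (twoLayersRealise (suc (suc (g + u))) (v + e′) (v + u) (v + g) (s≤s z≤n) 1≤B entry)
  where
    1≤B : 1 ≤ v + e′
    1≤B = ≤-trans 1≤v (m≤m+n v e′)
    size : suc (suc (g + u)) + (v + e′) ≡ suc (v + g) + (suc u + e′)
    size = solve (g ∷ v ∷ u ∷ e′ ∷ [])
    m≤A+B : v + u ≤ suc (suc (g + u)) + (v + e′)
    m≤A+B = ≤-by (suc (suc (g + e′))) (solve (v ∷ g ∷ u ∷ e′ ∷ []))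
    unarrived : v + u + 2 ≤ suc (suc (g + u)) + v
    unarrived = ≤-by g (solve (v ∷ g ∷ u ∷ []))
    position : v + g + (v + u) + 2 ≡ suc (suc (g + u)) + (v + v)
    position = solve (v ∷ g ∷ u ∷ [])
    entry : nth (label 1 (suc (v + e′)) (iter (v + u) step (twoBlocks (suc (suc (g + u))) (v + e′)))) (v + g) ≡ just v
    entry = movingSmall (evolve (v + u) (s≤s z≤n) 1≤B m≤A+B) 1≤v (m≤m+n v u) (m≤m+n v e′) unarrived position

-- For a large entry v = pos + 2 + h at time m = f + 1 + g, with n = v + f,
-- the bound v + m ≤ pos + n says g < pos.
startedBound : ∀ pos h f g → suc (suc pos) + h + (suc f + g) ≤ pos + (suc (suc pos) + h + f) → g < pos
startedBound pos h f g close = +-cancelˡ-≤ (suc (suc pos) + h + f) (suc g) pos (begin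
  suc (suc pos) + h + f + suc g    ≡⟨ solve (pos ∷ h ∷ f ∷ g ∷ []) ⟩
  suc (suc pos) + h + (suc f + g)  ≤⟨ close ⟩
  pos + (suc (suc pos) + h + f)    ≡⟨ +-comm pos _ ⟩
  suc (suc pos) + h + f + pos      ∎)
  where open ≤-Reasoning

-- The value v exceeds the position pos + 1, at distance H = v - pos - 1
-- ≤ n - 1 - m.  A large entry of ⊖(n - B, B) is used: the (pos + 1)-th one,
-- still resting, when m + v ≤ n and B = H; and otherwise, with
-- B = H + (m + v - n), the (B - v)-th one, which has moved exactly H steps.
largeEntry : ∀ {n m pos v} → suc pos < v → v ≤ n → v + m ≤ pos + n → Realisable n m pos v
largeEntry {m = m} {pos} pos+1<v v≤n close with m≤n⇒∃[o]m+o≡n pos+1<v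
... | h , refl with m≤n⇒∃[o]m+o≡n v≤n
... | f , refl with m ≤? f
... | yes m≤f with m≤n⇒∃[o]m+o≡n m≤f
...   | e , refl = realisable-cong m pos size value (twoLayersRealise (suc pos + (m + e)) (suc h) m pos (s≤s z≤n) (s≤s z≤n) entry)
  where
    size : suc pos + (m + e) + suc h ≡ suc (suc pos) + h + (m + e)
    size = solve (pos ∷ m ∷ e ∷ h ∷ [])
    value : suc h + suc pos ≡ suc (suc pos) + h
    value = solve (pos ∷ h ∷ [])
    m≤A+B : m ≤ suc pos + (m + e) + suc h
    m≤A+B = ≤-by (suc pos + e + suc h) (solve (pos ∷ m ∷ e ∷ h ∷ []))
    resting : suc pos + m ≤ suc pos + (m + e)
    resting = ≤-by e (solve (pos ∷ m ∷ e ∷ []))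
    entry : nth (label 1 (suc (suc h)) (iter m step (twoBlocks (suc pos + (m + e)) (suc h)))) pos ≡ just (suc h + suc pos)
    entry = restingLarge (evolve m (s≤s z≤n) (s≤s z≤n) m≤A+B) (s≤s z≤n) resting (+-comm pos 1)
largeEntry {m = m} {pos} pos+1<v v≤n close | h , refl | f , refl | no m≰f with m≤n⇒∃[o]m+o≡n (≰⇒> m≰f)
... | g , refl with m≤n⇒∃[o]m+o≡n (startedBound pos h f g close)
... | a , refl = realisable-cong (suc f + g) (suc g + a) size value
                   (twoLayersRealise (suc (a + f)) (suc (suc (h + g))) (suc f + g) (suc g + a) (s≤s z≤n) (s≤s z≤n) entry)
  where
    size : suc (a + f) + suc (suc (h + g)) ≡ suc (suc (suc g + a)) + h + f
    size = solve (a ∷ f ∷ h ∷ g ∷ [])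
    value : suc (suc (h + g)) + suc a ≡ suc (suc (suc g + a)) + h
    value = solve (a ∷ h ∷ g ∷ [])
    m≤A+B : suc f + g ≤ suc (a + f) + suc (suc (h + g))
    m≤A+B = ≤-by (suc (suc (a + h))) (solve (a ∷ f ∷ h ∷ g ∷ []))
    started : suc (a + f) < suc f + g + suc a
    started = ≤-by g (solve (a ∷ f ∷ g ∷ []))
    unarrived : suc f + g + suc a < suc (a + f) + suc (suc (h + g))
    unarrived = ≤-by h (solve (a ∷ f ∷ h ∷ g ∷ []))
    position : suc g + a + suc (a + f) + 1 ≡ suc a + suc a + (suc f + g)
    position = solve (a ∷ f ∷ g ∷ [])
    entry : nth (label 1 (suc (suc (suc (h + g)))) (iter (suc f + g) step (twoBlocks (suc (a + f)) (suc (suc (h + g))))))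
                (suc g + a) ≡ just (suc (suc (h + g)) + suc a)
    entry = movingLarge (evolve (suc f + g) (s≤s z≤n) (s≤s z≤n) m≤A+B) (s≤s z≤n) (s≤s (m≤m+n a f)) started unarrived position

lowerSlack : ∀ n′ m pos j → m ≤ n′ → suc pos ∸ (n′ ∸ m) ≤ j → pos + m + 1 < j + suc n′
lowerSlack n′ m pos j m≤n′ lower = begin-strict
  pos + m + 1                  <⟨ n<1+n _ ⟩
  suc pos + m + 1              ≤⟨ +-monoˡ-≤ 1 (+-monoˡ-≤ m (m≤n+m∸n (suc pos) d)) ⟩
  d + (suc pos ∸ d) + m + 1    ≤⟨ +-monoˡ-≤ 1 (+-monoˡ-≤ m (+-monoʳ-≤ d lower)) ⟩
  d + j + m + 1                ≡⟨ shuffle d ⟩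
  j + suc (d + m)              ≡⟨ cong (λ k → j + suc k) (m∸n+n≡m m≤n′) ⟩
  j + suc n′                   ∎
  where open ≤-Reasoning
        d : ℕ
        d = n′ ∸ m
        shuffle : ∀ e → e + j + m + 1 ≡ j + suc (e + m)
        shuffle e = solve (e ∷ j ∷ m ∷ [])

upperSlack : ∀ n′ m pos j → m ≤ n′ → j ≤ suc pos + (n′ ∸ m) → j + m ≤ pos + suc n′
upperSlack n′ m pos j m≤n′ upper = begin
  j + m                        ≤⟨ +-monoˡ-≤ m upper ⟩
  suc pos + d + m              ≡⟨ shuffle d ⟩
  pos + suc (d + m)            ≡⟨ cong (λ k → pos + suc k) (m∸n+n≡m m≤n′) ⟩
  pos + suc n′                 ∎
  where open ≤-Reasoning
        d : ℕ
        d = n′ ∸ m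
        shuffle : ∀ e → suc pos + e + m ≡ pos + suc (e + m)
        shuffle e = solve (pos ∷ e ∷ m ∷ [])

proposition24 : (n m i j : ℕ) → 1 ≤ n → m ≤ n ∸ 1 → 1 ≤ i → i ≤ n
    → 1 ≤ j → i ∸ (n ∸ 1 ∸ m) ≤ j → j ≤ n → j ≤ i + (n ∸ 1 ∸ m)
    → Σ (List ℕ) λ parts → Σ (List ℕ) λ π →
        All (1 ≤_) parts × sum parts ≡ n × π ≡ skewLayered parts × runs π ≤ 2
        × nth (iter m flipT π) (i ∸ 1) ≡ just j
proposition24 (suc n′) m (suc pos) j _ m≤n′ _ i≤n 1≤j lower j≤n upper with <-cmp (suc pos) j
... | tri≈ _ refl _ = identityRealises m pos i≤n
... | tri> _ _ j<i  = smallEntry 1≤j (≤-pred j<i) i≤n (lowerSlack n′ m pos j m≤n′ lower)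
... | tri< i<j _ _  = largeEntry i<j j≤n (upperSlack n′ m pos j m≤n′ upper)
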